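{- Let $w\ge 2$, $h\ge3$ and let $G=P_w(U)\sqcap C_h$ with $U=\{i,j\}\subseteq\{1,\dots,w\}$, $i<j$. Then $Z(G)\le h$.
   Context: All graphs are finite, simple and undirected. The path $P_n$ has vertex set $\{1,\dots,n\}$ and edges $\{k,k+1\}$ for $1\le k\le n-1$; the cycle $C_n$ ($n\ge3$) has vertex set $\{1,\dots,n\}$ and edges $\{k,k+1\}$ for $1\le k\le n-1$ together with $\{n,1\}$. For graphs $W,H$ and a subset $U\subseteq V(W)$ (the root set), the (generalized) hierarchical product $W(U)\sqcap H$ is the graph with vertex set $V(W)\times V(H)$ in which $(x_1,y_1)$ and $(x_2,y_2)$ are adjacent if and only if either ($x_1=x_2\in U$ and $y_1y_2\in E(H)$) or ($y_1=y_2$ and $x_1x_2\in E(W)$). Zero forcing: starting from a set $S$ of filled vertices, repeatedly apply the color change rule: if a filled vertex has exactly one unfilled neighbor, that neighbor becomes filled. $S$ is a zero forcing set if this eventually fills every vertex. The zero forcing number $Z(G)$ is the minimum size of a zero forcing set of $G$. -}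

module Defs where

open import Data.Nat using (ℕ; zero; suc; _∸_)
open import Data.Fin using (Fin; toℕ)
open import Data.Product using (_×_; _,_; ∃)
open import Data.Sum using (_⊎_)
open import Data.List using (List; length)
open import Data.List.Membership.Propositional using (_∈_)
open import Relation.Binary.PropositionalEquality using (_≡_; _≢_)
open import Data.Nat using (_≤_)

Rel : Set → Set₁
Rel V = V → V → Set

-- Path P_n on vertices Fin n (vertex k ∈ Fin n stands for k+1 ∈ {1..n}):
-- edges {k, k+1}.
PathAdj : (n : ℕ) → Rel (Fin n)
PathAdj n x y = (suc (toℕ x) ≡ toℕ y) ⊎ (suc (toℕ y) ≡ toℕ x)

CycleAdj : (n : ℕ) → Rel (Fin n)
CycleAdj n x y =
  PathAdj n x y
  ⊎ ((toℕ x ≡ n ∸ 1) × (toℕ y ≡ 0))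
  ⊎ ((toℕ y ≡ n ∸ 1) × (toℕ x ≡ 0))

HierAdj : {A B : Set} → Rel A → (A → Set) → Rel B → Rel (A × B)
HierAdj W U H (x₁ , y₁) (x₂ , y₂) =
  ((x₁ ≡ x₂) × U x₁ × H y₁ y₂) ⊎ ((y₁ ≡ y₂) × W x₁ x₂)

-- Vertices filled by the zero forcing process started from S
-- (the closure of S under the color change rule).
data Filled {V : Set} (G : Rel V) (S : List V) : V → Set where
  initial : ∀ {v} → v ∈ S → Filled G S v
  force   : ∀ {u v} → Filled G S u → G u v →
            (∀ x → G u x → x ≢ v → Filled G S x) → Filled G S v

ZeroForcingSet : {V : Set} → Rel V → List V → Set
ZeroForcingSet G S = ∀ v → Filled G S v

ZLe : {V : Set} → Rel V → ℕ → Set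
ZLe G k = ∃ λ S → length S ≤ k × ZeroForcingSet G S

-- The first copy {1} × V(H) of H already forces everything: once the copies
-- over path vertices 1, …, k are filled, each (k, y) has exactly one unfilled
-- neighbour, namely (k + 1, y), because all its other neighbours lie in the
-- copies over k − 1 and k.  So Z(P_w(U) ⊓ H) ≤ |V(H)| for every root set U and
-- every graph H.
module Submission where

open import Defs
open import Data.Nat using (ℕ; zero; suc; _≤_; z≤n; s≤s)
open import Data.Nat.Properties using (≤-refl; ≤-reflexive; <⇒≤; m≤n⇒m<n∨m≡n)
open import Data.Fin using (Fin; _<_; toℕ; inject₁)
import Data.Fin as Fin
open import Data.Fin.Properties using (toℕ-inject₁; toℕ-injective)
open import Data.Sum using (_⊎_; inj₁; inj₂)
open import Data.Product using (_×_; _,_)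
open import Data.List using (List; map; allFin)
open import Data.List.Properties using (length-map; length-tabulate)
open import Data.List.Membership.Propositional using (_∈_)
open import Data.List.Membership.Propositional.Properties using (∈-map⁺; ∈-allFin)
open import Relation.Binary.PropositionalEquality using (_≡_; _≢_; refl; sym; trans; cong)
open import Relation.Nullary using (contradiction)

firstCopy : {n : ℕ} {B : Set} → List B → List (Fin (suc n) × B)
firstCopy = map (Fin.zero ,_)

module _ {n : ℕ} {B : Set} (U : Fin (suc n) → Set) (H : Rel B)
         {ys : List B} (ys-complete : ∀ y → y ∈ ys) where

  private
    G : Rel (Fin (suc n) × B)
    G = HierAdj (PathAdj (suc n)) U H

    FilledUpTo : ℕ → Set
    FilledUpTo k = ∀ {x} y → toℕ x ≤ k → Filled G (firstCopy ys) (x , y)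

    firstCopy-filled : FilledUpTo 0
    firstCopy-filled {Fin.zero} y z≤n = initial (∈-map⁺ (Fin.zero ,_) (ys-complete y))

    forces-next : ∀ {k} → FilledUpTo k → (x : Fin n) → toℕ x ≡ k →
                  ∀ y → Filled G (firstCopy ys) (Fin.suc x , y)
    forces-next filled x refl y =
      force (filled y x′≤x) (inj₂ (refl , inj₁ (cong suc (toℕ-inject₁ x)))) others
      where
      x′≤x : toℕ (inject₁ x) ≤ toℕ x
      x′≤x = ≤-reflexive (toℕ-inject₁ x)

      others : ∀ v → G (inject₁ x , y) v → v ≢ (Fin.suc x , y) →
               Filled G (firstCopy ys) v
      others (_ , y′) (inj₁ (refl , _)) _ = filled y′ x′≤x
      others (c , _) (inj₂ (refl , inj₁ x′+1≡c)) v≢ =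
        contradiction (cong (_, y) (toℕ-injective (trans (sym x′+1≡c) (cong suc (toℕ-inject₁ x))))) v≢
      others (c , _) (inj₂ (refl , inj₂ c+1≡x′)) _ =
        filled y (<⇒≤ (≤-reflexive (trans c+1≡x′ (toℕ-inject₁ x))))

    filledUpTo-suc : ∀ {k} → FilledUpTo k → FilledUpTo (suc k)
    filledUpTo-suc filled {Fin.zero}  y _ = filled y z≤n
    filledUpTo-suc filled {Fin.suc x} y (s≤s x≤k) with m≤n⇒m<n∨m≡n x≤k
    ... | inj₁ x<k = filled y x<k
    ... | inj₂ x≡k = forces-next filled x x≡k y

    filledUpTo : ∀ k → FilledUpTo k
    filledUpTo zero    = firstCopy-filled
    filledUpTo (suc k) = filledUpTo-suc (filledUpTo k)

  firstCopy-zeroForcing : ZeroForcingSet G (firstCopy ys)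
  firstCopy-zeroForcing (x , y) = filledUpTo (toℕ x) y ≤-refl

ZLe-pathHierarchical : {n h : ℕ} (U : Fin (suc n) → Set) (H : Rel (Fin h)) →
                       ZLe (HierAdj (PathAdj (suc n)) U H) h
ZLe-pathHierarchical {h = h} U H =
  firstCopy (allFin h) ,
  ≤-reflexive (trans (length-map _ (allFin h)) (length-tabulate {n = h} (λ y → y))) ,
  firstCopy-zeroForcing U H ∈-allFin

mainTheorem9 : (w h : ℕ) → 2 ≤ w → 3 ≤ h → (i j : Fin w) → i < j →
    ZLe (HierAdj (PathAdj w) (λ u → (u ≡ i) ⊎ (u ≡ j)) (CycleAdj h)) h
mainTheorem9 (suc w) h _ _ i j _ =
  ZLe-pathHierarchical (λ u → (u ≡ i) ⊎ (u ≡ j)) (CycleAdj h)
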